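{- Let $Q=(Q_0,Q_1)$ be a quiver (finite, without loops and multiple edges). Then \[ \dim(\operatorname{DE}(Q))=\begin{cases} \#Q_0-\#\pi_0(Q)-1 & \text{if } Q \text{ has a rank function},\\ \#Q_0-\#\pi_0(Q) & \text{otherwise.}\end{cases} \]
   Context: A quiver is a pair $Q=(Q_0,Q_1)$ with $Q_0$ a finite set and $Q_1\subset (Q_0\times Q_0)\setminus\{(v,v)\mid v\in Q_0\}$; elements $(v,w)\in Q_1$ are edges from $v$ to $w$. For $v\in Q_0$ let $\kappa_{\{v\}}\in\mathbb{R}^{Q_0}$ be the indicator function of $v$ (the standard basis of the space $\mathbb{R}^{Q_0}$ of functions $Q_0\to\mathbb{R}$), and $\varepsilon_{(v,w)}=\kappa_{\{v\}}-\kappa_{\{w\}}$. The directed edge polytope is $\operatorname{DE}(Q)=\operatorname{conv}\{\varepsilon_{(v,w)}\mid (v,w)\in Q_1\}\subset\mathbb{R}^{Q_0}$ (the empty polytope has dimension $-1$). An undirected walk is a sequence $(v_0,\dots,v_n)$ of vertices with $(v_t,v_{t+1})\in Q_1$ or $(v_{t+1},v_t)\in Q_1$ for all $t$; $Q$ is connected if any two vertices are joined by an undirected walk, and $\pi_0(Q)$ is the set of connected components (maximal connected subquivers). A rank function of $Q$ is a function $\rho:Q_0\to\mathbb{R}$ with $\rho(v)+1=\rho(w)$ for every edge $(v,w)\in Q_1$.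
   Formalization: The directed edge polytope lies in ℚ^Q₀ instead of $\mathbb{R}^{Q_0}$, its dimension is counted with rational points and coefficients, and rank functions take rational values. -}

module Defs where

open import Data.Nat using (ℕ; zero; suc)
open import Data.Fin using (Fin; zero; suc; _≟_)
open import Data.Bool using (Bool; true; false)
open import Data.Product using (Σ; _×_; _,_; ∃)
open import Data.Integer as ℤ using (ℤ; +_)
open import Data.Rational using (ℚ; 0ℚ; 1ℚ; _+_; _*_; _-_; _≤_)
open import Relation.Nullary using (¬_; does)
open import Relation.Binary.PropositionalEquality using (_≡_)
open import Function.Bundles using (_⇔_)

record Quiver (n : ℕ) : Set where
  field
    edge   : Fin n → Fin n → Bool
    noLoop : ∀ v → edge v v ≡ false
open Quiver public

Vect : ℕ → Set
Vect n = Fin n → ℚ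

∑ : ∀ {k} → (Fin k → ℚ) → ℚ
∑ {zero}  f = 0ℚ
∑ {suc k} f = f zero + ∑ (λ i → f (suc i))

κ : ∀ {n} → Fin n → Vect n
κ v u with does (v ≟ u)
... | true  = 1ℚ
... | false = 0ℚ

ε : ∀ {n} → Fin n → Fin n → Vect n
ε v w u = κ v u - κ w u

-- Directed edge polytope: convex hull of {ε_e | e ∈ Q₁}, as a predicate on ℚ^{Q₀}.
DE : ∀ {n} → Quiver n → Vect n → Set
DE {n} Q x =
  Σ (Fin n → Fin n → ℚ) λ λ′ →
      (∀ v w → 0ℚ ≤ λ′ v w)
    × (∀ v w → edge Q v w ≡ false → λ′ v w ≡ 0ℚ)
    × (∑ (λ v → ∑ (λ w → λ′ v w)) ≡ 1ℚ)
    × (∀ u → x u ≡ ∑ (λ v → ∑ (λ w → λ′ v w * ε v w u)))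

AffinelyIndependent : ∀ {n k} → (Fin k → Vect n) → Set
AffinelyIndependent {n} {k} p =
  ∀ (c : Fin k → ℚ) → ∑ c ≡ 0ℚ → (∀ u → ∑ (λ i → c i * p i u) ≡ 0ℚ) → ∀ i → c i ≡ 0ℚ

-- dim S = d  (d ∈ ℤ, empty set has dimension -1):
-- S contains d+1 affinely independent points, and no affinely independent
-- family in S has more than d+1 points.
HasDim : ∀ {n} → (Vect n → Set) → ℤ → Set
HasDim {n} S d =
    (Σ ℕ λ k → (+ k ≡ d ℤ.+ ℤ.1ℤ) × Σ (Fin k → Vect n) λ p → (∀ i → S (p i)) × AffinelyIndependent p)
  × (∀ k (p : Fin k → Vect n) → (∀ i → S (p i)) → AffinelyIndependent p → + k ℤ.≤ d ℤ.+ ℤ.1ℤ)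

data Connected {n} (Q : Quiver n) : Fin n → Fin n → Set where
  here : ∀ {v} → Connected Q v v
  fwd  : ∀ {u v w} → edge Q u v ≡ true → Connected Q v w → Connected Q u w
  bwd  : ∀ {u v w} → edge Q v u ≡ true → Connected Q v w → Connected Q u w

-- #π₀(Q) = c : a surjective labelling of vertices by Fin c whose fibres are
-- exactly the connected components.
NumComponents : ∀ {n} → Quiver n → ℕ → Set
NumComponents {n} Q c =
  Σ (Fin n → Fin c) λ f →
      (∀ v w → (f v ≡ f w) ⇔ Connected Q v w)
    × (∀ (j : Fin c) → ∃ λ v → f v ≡ j)

RankFunction : ∀ {n} → Quiver n → (Fin n → ℚ) → Set
RankFunction Q ρ = ∀ v w → edge Q v w ≡ true → ρ v + 1ℚ ≡ ρ w

HasRankFunction : ∀ {n} → Quiver n → Set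
HasRankFunction {n} Q = Σ (Fin n → ℚ) (RankFunction Q)

-- Take a spanning forest of Q: one tree per connected component, hence n − c edges.  Its
-- edge vectors are linearly independent and span every ε_(v,w) with v, w in one tree, so they
-- span DE(Q); thus DE(Q) has at most n − c + 1 affinely independent points.  A rank function ρ
-- puts DE(Q) in the hyperplane ρ · x = −1, which misses 0, so affinely independent points of
-- DE(Q) are even linearly independent: at most n − c of them, and the forest's edge vectors
-- attain this.  The forest itself always has a rank function (its `height`); if Q has none,
-- some edge e of Q violates it, so ε_e lies off the hyperplane height · x = −1 through the
-- forest's edge vectors, and together they are n − c + 1 affinely independent points.

module Submission where

open import Algebra.Bundles using (CommutativeRing)
open import Data.Bool using (true; false)
open import Data.Bool.Properties as Bool using ()
open import Data.Fin as Fin using (Fin; zero; suc; punchIn; punchOut)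
open import Data.Fin.Properties as Fin using (punchInᵢ≢i; punchOut-cong; punchOut-injective; punchOut-punchIn)
open import Data.Integer as ℤ using (ℤ; 1ℤ)
open import Data.Integer.Properties as ℤ using ()
open import Data.Integer.Tactic.RingSolver using (solve-∀)
open import Data.List as List using (List; []; cartesianProduct; allFin)
open import Data.List.Membership.Propositional using (_∈_)
open import Data.List.Membership.Propositional.Properties using (∈-cartesianProduct⁺; ∈-allFin)
open import Data.List.Relation.Unary.Any using (here; there)
open import Data.Nat as ℕ using (ℕ; zero; suc)
open import Data.Nat.Properties as ℕ using ()
open import Data.Product using (Σ; _×_; _,_; ∃; proj₁; proj₂)
open import Data.Rational as ℚ using (ℚ; 0ℚ; 1ℚ; _+_; _*_; _-_; -_; 1/_)
open import Data.Rational.Properties as ℚ using ()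
open import Data.Rational.Solver using (module +-*-Solver)
open import Data.Sum using (_⊎_; inj₁; inj₂)
open import Data.Vec.Functional using (_∷_; insertAt)
open import Data.Vec.Functional.Properties using (insertAt-lookup; insertAt-punchIn)
open import Function.Base using (_∘_)
open import Function.Bundles using (Equivalence)
open import Relation.Binary.PropositionalEquality
open import Relation.Nullary using (¬_; yes; no; ¬?; contradiction)
open import Relation.Nullary.Decidable using (decidable-stable; _×-dec_)
import Algebra.Properties.Semiring.Sum (CommutativeRing.semiring ℚ.+-*-commutativeRing) as Sum
open Sum using (sum)

open import Defs

open +-*-Solver

-- Finite sums

∑≡sum : ∀ {k} (f : Fin k → ℚ) → ∑ f ≡ sum f
∑≡sum {zero}  f = refl
∑≡sum {suc k} f = cong (f zero +_) (∑≡sum (λ i → f (suc i)))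

∑-cong : ∀ {k} {f g : Fin k → ℚ} → f ≗ g → ∑ f ≡ ∑ g
∑-cong {f = f} {g} f≗g = trans (∑≡sum f) (trans (Sum.sum-cong-≗ f≗g) (sym (∑≡sum g)))

∑-zero : ∀ k → ∑ {k} (λ _ → 0ℚ) ≡ 0ℚ
∑-zero k = trans (∑≡sum {k} (λ _ → 0ℚ)) (Sum.sum-replicate-zero k)

∑-distrib-+ : ∀ {k} (f g : Fin k → ℚ) → ∑ (λ i → f i + g i) ≡ ∑ f + ∑ g
∑-distrib-+ f g rewrite ∑≡sum f | ∑≡sum g | ∑≡sum (λ i → f i + g i) = Sum.∑-distrib-+ f g

∑-*ˡ : ∀ {k} (x : ℚ) (f : Fin k → ℚ) → ∑ (λ i → x * f i) ≡ x * ∑ f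
∑-*ˡ x f rewrite ∑≡sum f | ∑≡sum (λ i → x * f i) = sym (Sum.*-distribˡ-sum x f)

∑-*ʳ : ∀ {k} (x : ℚ) (f : Fin k → ℚ) → ∑ (λ i → f i * x) ≡ ∑ f * x
∑-*ʳ x f = trans (∑-cong (λ i → ℚ.*-comm (f i) x)) (trans (∑-*ˡ x f) (ℚ.*-comm x (∑ f)))

∑-comm : ∀ {k l} (F : Fin k → Fin l → ℚ) → ∑ (λ i → ∑ (F i)) ≡ ∑ (λ j → ∑ (λ i → F i j))
∑-comm F = trans (∑∑≡ F) (trans (Sum.∑-comm F) (sym (∑∑≡ (λ j i → F i j))))
  where
  ∑∑≡ : ∀ {k l} (G : Fin k → Fin l → ℚ) → ∑ (λ i → ∑ (G i)) ≡ sum (λ i → sum (G i))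
  ∑∑≡ G = trans (∑-cong (λ i → ∑≡sum (G i))) (∑≡sum (λ i → sum (G i)))

∑-remove : ∀ {k} (i : Fin (suc k)) (f : Fin (suc k) → ℚ) → ∑ f ≡ f i + ∑ (λ j → f (punchIn i j))
∑-remove i f rewrite ∑≡sum f | ∑≡sum (λ j → f (punchIn i j)) = Sum.sum-remove {i = i} f

κ-diag : ∀ {n} (v : Fin n) → κ v v ≡ 1ℚ
κ-diag v with v Fin.≟ v
... | yes _   = refl
... | no v≢v = contradiction refl v≢v

κ-off : ∀ {n} {v u : Fin n} → v ≢ u → κ v u ≡ 0ℚ
κ-off {v = v} {u} v≢u with v Fin.≟ u
... | yes v≡u = contradiction v≡u v≢u
... | no _    = refl

∑-*κ : ∀ {n} (h : Vect n) (v : Fin n) → ∑ (λ u → h u * κ v u) ≡ h v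
∑-*κ {suc n} h v = begin
  ∑ (λ u → h u * κ v u)
    ≡⟨ ∑-remove v (λ u → h u * κ v u) ⟩
  h v * κ v v + ∑ (λ j → h (punchIn v j) * κ v (punchIn v j))
    ≡⟨ cong₂ _+_ (cong (h v *_) (κ-diag v)) (trans (∑-cong off) (∑-zero n)) ⟩
  h v * 1ℚ + 0ℚ
    ≡⟨ solve 1 (λ x → x :* con 1ℚ :+ con 0ℚ := x) refl (h v) ⟩
  h v ∎
  where
  open ≡-Reasoning
  off : ∀ j → h (punchIn v j) * κ v (punchIn v j) ≡ 0ℚ
  off j = trans (cong (h (punchIn v j) *_) (κ-off (punchInᵢ≢i v j ∘ sym))) (ℚ.*-zeroʳ (h (punchIn v j)))

ε-self : ∀ {n} (v : Fin n) → ε v v ≗ λ _ → 0ℚ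
ε-self v u = ℚ.+-inverseʳ (κ v u)

ε-swap : ∀ {n} (v w : Fin n) → ε v w ≗ λ u → - 1ℚ * ε w v u
ε-swap v w u = solve 2 (λ x y → x :- y := con (- 1ℚ) :* (y :- x)) refl (κ v u) (κ w u)

-- Linear algebra over ℚ

x*y≡0⇒x≡0 : ∀ {x y : ℚ} → y ≢ 0ℚ → x * y ≡ 0ℚ → x ≡ 0ℚ
x*y≡0⇒x≡0 {x} {y} y≢0 xy≡0 = begin
  x              ≡⟨ sym (ℚ.*-identityʳ x) ⟩
  x * 1ℚ         ≡⟨ cong (x *_) (sym (ℚ.*-inverseʳ y)) ⟩
  x * (y * 1/ y) ≡⟨ sym (ℚ.*-assoc x y (1/ y)) ⟩
  x * y * 1/ y   ≡⟨ cong (_* 1/ y) xy≡0 ⟩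
  0ℚ * 1/ y      ≡⟨ ℚ.*-zeroˡ (1/ y) ⟩
  0ℚ             ∎
  where
  open ≡-Reasoning
  instance
    y-nonZero : ℚ.NonZero y
    y-nonZero = ℚ.≢-nonZero y≢0

infix 8 _·_
_·_ : ∀ {n} → Vect n → Vect n → ℚ
h · x = ∑ (λ u → h u * x u)

lincomb : ∀ {n k} → (Fin k → ℚ) → (Fin k → Vect n) → Vect n
lincomb c P u = ∑ (λ i → c i * P i u)

LinearlyIndependent : ∀ {n k} → (Fin k → Vect n) → Set
LinearlyIndependent P = ∀ c → (∀ u → lincomb c P u ≡ 0ℚ) → ∀ i → c i ≡ 0ℚ

LinearlyDependent : ∀ {n k} → (Fin k → Vect n) → Set
LinearlyDependent P = ∃ λ c → (∀ u → lincomb c P u ≡ 0ℚ) × ∃ λ i → c i ≢ 0ℚ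

InSpan : ∀ {n m} → (Fin m → Vect n) → Vect n → Set
InSpan T x = ∃ λ a → x ≗ lincomb a T

module _ {n} (h : Vect n) where

  ·-cong : ∀ {x y} → x ≗ y → h · x ≡ h · y
  ·-cong x≗y = ∑-cong (λ u → cong (h u *_) (x≗y u))

  ·-zero : ∀ {x} → (∀ u → x u ≡ 0ℚ) → h · x ≡ 0ℚ
  ·-zero x≗0 = trans (·-cong x≗0) (trans (∑-cong (λ u → ℚ.*-zeroʳ (h u))) (∑-zero n))

  ·-* : (r : ℚ) (x : Vect n) → h · (λ u → r * x u) ≡ r * h · x
  ·-* r x = trans (∑-cong (λ u → solve 3 (λ y r z → y :* (r :* z) := r :* (y :* z)) refl (h u) r (x u)))
                  (∑-*ˡ r (λ u → h u * x u))

  ·-ε : ∀ v w → h · ε v w ≡ h v - h w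
  ·-ε v w = begin
    ∑ (λ u → h u * (κ v u - κ w u))
      ≡⟨ ∑-cong (λ u → solve 3 (λ x a b → x :* (a :- b) := x :* a :+ (x :* b) :* con (- 1ℚ)) refl (h u) (κ v u) (κ w u)) ⟩
    ∑ (λ u → h u * κ v u + h u * κ w u * - 1ℚ)
      ≡⟨ ∑-distrib-+ (λ u → h u * κ v u) (λ u → h u * κ w u * - 1ℚ) ⟩
    ∑ (λ u → h u * κ v u) + ∑ (λ u → h u * κ w u * - 1ℚ)
      ≡⟨ cong₂ _+_ (∑-*κ h v) (trans (∑-*ʳ (- 1ℚ) (λ u → h u * κ w u)) (cong (_* - 1ℚ) (∑-*κ h w))) ⟩
    h v + h w * - 1ℚ
      ≡⟨ solve 2 (λ a b → a :+ b :* con (- 1ℚ) := a :- b) refl (h v) (h w) ⟩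
    h v - h w ∎
    where open ≡-Reasoning

  ·-∑ : ∀ {k} (P : Fin k → Vect n) → h · (λ u → ∑ (λ i → P i u)) ≡ ∑ (λ i → h · P i)
  ·-∑ P = trans (∑-cong (λ u → sym (∑-*ˡ (h u) (λ i → P i u)))) (∑-comm (λ u i → h u * P i u))

  ·-lincomb : ∀ {k} (c : Fin k → ℚ) (P : Fin k → Vect n) → h · lincomb c P ≡ ∑ (λ i → c i * h · P i)
  ·-lincomb c P = trans (·-∑ (λ i u → c i * P i u)) (∑-cong (λ i → ·-* (c i) (P i)))

lincomb-vanishes : ∀ {n m} {a : Fin m → ℚ} (T : Fin m → Vect n) → (∀ t → a t ≡ 0ℚ) → ∀ u → lincomb a T u ≡ 0ℚ
lincomb-vanishes {m = m} T a≡0 u = trans (∑-cong (λ t → trans (cong (_* T t u) (a≡0 t)) (ℚ.*-zeroˡ (T t u)))) (∑-zero m)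

lincomb-lincomb : ∀ {n m k} (c : Fin k → ℚ) (A : Fin k → Fin m → ℚ) (T : Fin m → Vect n) →
                  lincomb c (λ i → lincomb (A i) T) ≗ lincomb (lincomb c A) T
lincomb-lincomb c A T u = begin
  ∑ (λ i → c i * ∑ (λ t → A i t * T t u))   ≡⟨ ∑-cong (λ i → sym (∑-*ˡ (c i) (λ t → A i t * T t u))) ⟩
  ∑ (λ i → ∑ (λ t → c i * (A i t * T t u))) ≡⟨ ∑-comm (λ i t → c i * (A i t * T t u)) ⟩
  ∑ (λ t → ∑ (λ i → c i * (A i t * T t u))) ≡⟨ ∑-cong (λ t → ∑-cong (λ i → sym (ℚ.*-assoc (c i) (A i t) (T t u)))) ⟩
  ∑ (λ t → ∑ (λ i → c i * A i t * T t u))   ≡⟨ ∑-cong (λ t → ∑-*ʳ (T t u) (λ i → c i * A i t)) ⟩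
  ∑ (λ t → lincomb c A t * T t u)           ∎
  where open ≡-Reasoning

module _ {n m} (T : Fin m → Vect n) where

  InSpan-zero : InSpan T (λ _ → 0ℚ)
  InSpan-zero = (λ _ → 0ℚ) , λ u → sym (lincomb-vanishes T (λ _ → refl) u)

  InSpan-+ : ∀ {x y} → InSpan T x → InSpan T y → InSpan T (λ u → x u + y u)
  InSpan-+ {x} {y} (a , x≗) (b , y≗) = (λ t → a t + b t) , λ u → begin
    x u + y u                                ≡⟨ cong₂ _+_ (x≗ u) (y≗ u) ⟩
    lincomb a T u + lincomb b T u            ≡⟨ sym (∑-distrib-+ (λ t → a t * T t u) (λ t → b t * T t u)) ⟩
    ∑ (λ t → a t * T t u + b t * T t u)      ≡⟨ ∑-cong (λ t → sym (ℚ.*-distribʳ-+ (T t u) (a t) (b t))) ⟩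
    lincomb (λ t → a t + b t) T u            ∎
    where open ≡-Reasoning

  InSpan-* : ∀ {x} (r : ℚ) → InSpan T x → InSpan T (λ u → r * x u)
  InSpan-* {x} r (a , x≗) = (λ t → r * a t) , λ u → begin
    r * x u                           ≡⟨ cong (r *_) (x≗ u) ⟩
    r * lincomb a T u                 ≡⟨ sym (∑-*ˡ r (λ t → a t * T t u)) ⟩
    ∑ (λ t → r * (a t * T t u))       ≡⟨ ∑-cong (λ t → sym (ℚ.*-assoc r (a t) (T t u))) ⟩
    lincomb (λ t → r * a t) T u       ∎
    where open ≡-Reasoning

  InSpan-∑ : ∀ {k} (P : Fin k → Vect n) → (∀ i → InSpan T (P i)) → InSpan T (λ u → ∑ (λ i → P i u))
  InSpan-∑ {zero}  P _  = InSpan-zero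
  InSpan-∑ {suc k} P sp = InSpan-+ (sp zero) (InSpan-∑ (λ i → P (suc i)) (λ i → sp (suc i)))

  InSpan-resp : ∀ {x y} → x ≗ y → InSpan T y → InSpan T x
  InSpan-resp x≗y (a , y≗) = a , λ u → trans (x≗y u) (y≗ u)

  InSpan-∷ : ∀ {x} (e : Vect n) → InSpan T x → InSpan (e ∷ T) x
  InSpan-∷ e (a , x≗) = (0ℚ ∷ a) , λ u → trans (x≗ u)
    (sym (trans (cong (_+ lincomb a T u) (ℚ.*-zeroˡ (e u))) (ℚ.+-identityˡ (lincomb a T u))))

  InSpan-head : ∀ (e : Vect n) → InSpan (e ∷ T) e
  InSpan-head e = (1ℚ ∷ λ _ → 0ℚ) , λ u → sym (begin
    1ℚ * e u + lincomb (λ _ → 0ℚ) T u  ≡⟨ cong₂ _+_ (ℚ.*-identityˡ (e u)) (lincomb-vanishes T (λ _ → refl) u) ⟩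
    e u + 0ℚ                           ≡⟨ ℚ.+-identityʳ (e u) ⟩
    e u                                ∎)
    where open ≡-Reasoning

lincomb≡0-if-heads≡0 : ∀ {m k} {c : Fin k → ℚ} (P : Fin k → Vect (suc m)) → (∀ i → P i zero ≡ 0ℚ) →
                       (∀ u → lincomb c P (suc u) ≡ 0ℚ) → ∀ u → lincomb c P u ≡ 0ℚ
lincomb≡0-if-heads≡0 {k = k} {c} P heads≡0 tail≡0 zero    =
  trans (∑-cong (λ i → trans (cong (c i *_) (heads≡0 i)) (ℚ.*-zeroʳ (c i)))) (∑-zero k)
lincomb≡0-if-heads≡0             P heads≡0 tail≡0 (suc u) = tail≡0 u

-- Gaussian elimination of the first coordinate, with pivot row p.
module Elimination {m k} (P : Fin (suc k) → Vect (suc m)) (p : Fin (suc k)) (pivot≢0 : P p zero ≢ 0ℚ) where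

  instance
    pivot-nonZero : ℚ.NonZero (P p zero)
    pivot-nonZero = ℚ.≢-nonZero pivot≢0

  multiplier : Fin k → ℚ
  multiplier j = P (punchIn p j) zero * 1/ P p zero

  eliminated : Fin k → Vect (suc m)
  eliminated j u = P (punchIn p j) u - multiplier j * P p u

  eliminated-head : ∀ j → eliminated j zero ≡ 0ℚ
  eliminated-head j = begin
    x - x * 1/ α * α   ≡⟨ cong (λ y → x - y) (ℚ.*-assoc x (1/ α) α) ⟩
    x - x * (1/ α * α) ≡⟨ cong (λ y → x - x * y) (ℚ.*-inverseˡ α) ⟩
    x - x * 1ℚ         ≡⟨ solve 1 (λ x → x :- x :* con 1ℚ := con 0ℚ) refl x ⟩
    0ℚ                 ∎
    where
    open ≡-Reasoning
    x α : ℚ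
    x = P (punchIn p j) zero
    α = P p zero

  lift : (d : Fin k → ℚ) → Fin (suc k) → ℚ
  lift d = insertAt d p (- ∑ (λ j → d j * multiplier j))

  lincomb-lift : ∀ d u → lincomb (lift d) P u ≡ lincomb d eliminated u
  lincomb-lift d u = begin
    lincomb (lift d) P u
      ≡⟨ ∑-remove p (λ i → lift d i * P i u) ⟩
    lift d p * P p u + ∑ (λ j → lift d (punchIn p j) * P (punchIn p j) u)
      ≡⟨ cong₂ (λ a b → a * P p u + b) (insertAt-lookup d p (- S))
               (∑-cong (λ j → cong (_* P (punchIn p j) u) (insertAt-punchIn d p (- S) j))) ⟩
    - S * P p u + X
      ≡⟨ solve 3 (λ s y x → :- s :* y :+ x := x :+ s :* (:- y)) refl S (P p u) X ⟩
    X + S * - P p u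
      ≡⟨ cong (X +_) (sym (∑-*ʳ (- P p u) (λ j → d j * multiplier j))) ⟩
    X + ∑ (λ j → d j * multiplier j * - P p u)
      ≡⟨ sym (∑-distrib-+ (λ j → d j * P (punchIn p j) u) (λ j → d j * multiplier j * - P p u)) ⟩
    ∑ (λ j → d j * P (punchIn p j) u + d j * multiplier j * - P p u)
      ≡⟨ ∑-cong (λ j → solve 4 (λ d x r y → d :* x :+ d :* r :* (:- y) := d :* (x :- r :* y))
                               refl (d j) (P (punchIn p j) u) (multiplier j) (P p u)) ⟩
    lincomb d eliminated u ∎
    where
    open ≡-Reasoning
    S X : ℚ
    S = ∑ (λ j → d j * multiplier j)
    X = ∑ (λ j → d j * P (punchIn p j) u)

  dependent-lift : LinearlyDependent (λ j u → eliminated j (suc u)) → LinearlyDependent P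
  dependent-lift (d , rel , j , dj≢0) =
    lift d ,
    (λ u → trans (lincomb-lift d u) (lincomb≡0-if-heads≡0 {c = d} eliminated eliminated-head rel u)) ,
    punchIn p j , λ lift≡0 → dj≢0 (trans (sym (insertAt-punchIn d p _ j)) lift≡0)

dim<⇒dependent : ∀ {m k} (P : Fin k → Vect m) → m ℕ.< k → LinearlyDependent P
dim<⇒dependent {zero}  {suc k} P _ = (λ _ → 1ℚ) , (λ ()) , zero , ℚ.1≢0
dim<⇒dependent {suc m} {suc k} P (ℕ.s≤s m<k) with Fin.any? (λ i → ¬? (P i zero ℚ.≟ 0ℚ))
... | yes (p , pivot≢0) =
  Elimination.dependent-lift P p pivot≢0 (dim<⇒dependent _ m<k)
... | no no-pivot =
  let c , rel , nontrivial = dim<⇒dependent (λ i u → P i (suc u)) (ℕ.m<n⇒m<1+n m<k)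
  in c , lincomb≡0-if-heads≡0 {c = c} P heads≡0 rel , nontrivial
  where
  heads≡0 : ∀ i → P i zero ≡ 0ℚ
  heads≡0 i = decidable-stable (P i zero ℚ.≟ 0ℚ) (λ ≢0 → no-pivot (i , ≢0))

span-dependent : ∀ {n m k} (T : Fin m → Vect n) (p : Fin k → Vect n) →
                 (∀ i → InSpan T (p i)) → m ℕ.< k → LinearlyDependent p
span-dependent {m = m} {k} T p spanned m<k =
  let c , rel , nontrivial = dim<⇒dependent A m<k in c , relation c rel , nontrivial
  where
  A : Fin k → Fin m → ℚ
  A i = proj₁ (spanned i)
  relation : ∀ c → (∀ t → lincomb c A t ≡ 0ℚ) → ∀ u → lincomb c p u ≡ 0ℚ
  relation c rel u = begin
    lincomb c p u                         ≡⟨ ∑-cong (λ i → cong (c i *_) (proj₂ (spanned i) u)) ⟩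
    lincomb c (λ i → lincomb (A i) T) u   ≡⟨ lincomb-lincomb c A T u ⟩
    lincomb (lincomb c A) T u             ≡⟨ lincomb-vanishes T rel u ⟩
    0ℚ                                    ∎
    where open ≡-Reasoning

independent-in-span⇒≤ : ∀ {n m k} (T : Fin m → Vect n) (p : Fin k → Vect n) →
                        (∀ i → InSpan T (p i)) → LinearlyIndependent p → k ℕ.≤ m
independent-in-span⇒≤ T p spanned independent = ℕ.≮⇒≥ λ m<k →
  let c , rel , i , c[i]≢0 = span-dependent T p spanned m<k in c[i]≢0 (independent c rel i)

linear⇒affine : ∀ {n k} {p : Fin k → Vect n} → LinearlyIndependent p → AffinelyIndependent p
linear⇒affine independent c _ = independent c

affine⇒linear : ∀ {n k} (h : Vect n) {a : ℚ} {p : Fin k → Vect n} → a ≢ 0ℚ →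
                (∀ i → h · p i ≡ a) → AffinelyIndependent p → LinearlyIndependent p
affine⇒linear h {a} {p} a≢0 on-hyperplane affine c rel = affine c ∑c≡0 rel
  where
  open ≡-Reasoning
  ∑c≡0 : ∑ c ≡ 0ℚ
  ∑c≡0 = x*y≡0⇒x≡0 a≢0 (begin
    ∑ c * a                  ≡⟨ sym (∑-*ʳ a c) ⟩
    ∑ (λ i → c i * a)        ≡⟨ ∑-cong (λ i → cong (c i *_) (sym (on-hyperplane i))) ⟩
    ∑ (λ i → c i * h · p i)  ≡⟨ sym (·-lincomb h c p) ⟩
    h · lincomb c p          ≡⟨ ·-zero h rel ⟩
    0ℚ                       ∎)

homogenise : ∀ {n k} → (Fin k → Vect n) → Fin k → Vect (suc n)
homogenise p i = 1ℚ ∷ p i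

affine⇒homogenised-linear : ∀ {n k} {p : Fin k → Vect n} → AffinelyIndependent p → LinearlyIndependent (homogenise p)
affine⇒homogenised-linear affine c rel =
  affine c (trans (∑-cong (λ i → sym (ℚ.*-identityʳ (c i)))) (rel zero)) (λ u → rel (suc u))

homogenised-span : ∀ {n m} → (Fin m → Vect n) → Fin (suc m) → Vect (suc n)
homogenised-span T = (1ℚ ∷ λ _ → 0ℚ) ∷ λ t → 0ℚ ∷ T t

InSpan-homogenise : ∀ {n m} (T : Fin m → Vect n) {x} → InSpan T x → InSpan (homogenised-span T) (1ℚ ∷ x)
InSpan-homogenise {m = m} T {x} (a , x≗) = (1ℚ ∷ a) , coordinates
  where
  coordinates : (1ℚ ∷ x) ≗ lincomb (1ℚ ∷ a) (homogenised-span T)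
  coordinates zero    = sym (cong (1ℚ +_) (trans (∑-cong (λ t → ℚ.*-zeroʳ (a t))) (∑-zero m)))
  coordinates (suc u) = trans (x≗ u) (sym (ℚ.+-identityˡ (lincomb a T u)))

module _ {n m} {T : Fin m → Vect n} {x : Vect n} where

  independent-∷ : LinearlyIndependent T → ∀ c → c zero ≡ 0ℚ → (∀ u → lincomb c (x ∷ T) u ≡ 0ℚ) → ∀ i → c i ≡ 0ℚ
  independent-∷ _           c c₀≡0 _   zero    = c₀≡0
  independent-∷ independent c c₀≡0 rel (suc i) = independent (λ t → c (suc t)) tail≡0 i
    where
    tail≡0 : ∀ u → lincomb (λ t → c (suc t)) T u ≡ 0ℚ
    tail≡0 u = begin
      lincomb (λ t → c (suc t)) T u               ≡⟨ sym (ℚ.+-identityˡ _) ⟩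
      0ℚ + lincomb (λ t → c (suc t)) T u          ≡⟨ cong (_+ lincomb (λ t → c (suc t)) T u) head≡0 ⟩
      c zero * x u + lincomb (λ t → c (suc t)) T u ≡⟨ rel u ⟩
      0ℚ                                           ∎
      where
      open ≡-Reasoning
      head≡0 : 0ℚ ≡ c zero * x u
      head≡0 = sym (trans (cong (_* x u) c₀≡0) (ℚ.*-zeroˡ (x u)))

  head≡0-off-hyperplane : (h : Vect n) {a : ℚ} → (∀ t → h · T t ≡ a) → h · x ≢ a →
                          ∀ c → (∀ u → lincomb c (x ∷ T) u ≡ 0ℚ) → a * ∑ c ≡ 0ℚ → c zero ≡ 0ℚ
  head≡0-off-hyperplane h {a} on-hyperplane off c rel a∑c≡0 = x*y≡0⇒x≡0 gap≢0 (begin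
    c₀ * (h · x - a)
      ≡⟨ solve 4 (λ c₀ y a s → c₀ :* (y :- a) := (c₀ :* y :+ s :* a) :- a :* (c₀ :+ s)) refl c₀ (h · x) a ∑tail ⟩
    (c₀ * h · x + ∑tail * a) - a * ∑ c    ≡⟨ cong₂ _-_ image≡0 a∑c≡0 ⟩
    0ℚ - 0ℚ                               ≡⟨⟩
    0ℚ                                    ∎)
    where
    open ≡-Reasoning
    c₀ ∑tail : ℚ
    c₀ = c zero
    ∑tail = ∑ (λ t → c (suc t))
    image≡0 : c₀ * h · x + ∑tail * a ≡ 0ℚ
    image≡0 = begin
      c₀ * h · x + ∑tail * a                ≡⟨ cong (c₀ * h · x +_) (sym (∑-*ʳ a (λ t → c (suc t)))) ⟩
      c₀ * h · x + ∑ (λ t → c (suc t) * a)  ≡⟨ cong (c₀ * h · x +_) (∑-cong (λ t → cong (c (suc t) *_) (sym (on-hyperplane t)))) ⟩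
      ∑ (λ i → c i * h · (x ∷ T) i)         ≡⟨ sym (·-lincomb h c (x ∷ T)) ⟩
      h · lincomb c (x ∷ T)                 ≡⟨ ·-zero h rel ⟩
      0ℚ                                    ∎
    gap≢0 : h · x - a ≢ 0ℚ
    gap≢0 gap≡0 = off (begin
      h · x               ≡⟨ solve 2 (λ y a → y := (y :- a) :+ a) refl (h · x) a ⟩
      (h · x - a) + a     ≡⟨ cong (_+ a) gap≡0 ⟩
      0ℚ + a              ≡⟨ ℚ.+-identityˡ a ⟩
      a                   ∎)

  independent-∷-transversal : LinearlyIndependent T → (h : Vect n) → (∀ t → h · T t ≡ 0ℚ) → h · x ≢ 0ℚ →
                              LinearlyIndependent (x ∷ T)
  independent-∷-transversal independent h ⊥T hx≢0 c rel =
    independent-∷ independent c (head≡0-off-hyperplane h ⊥T hx≢0 c rel (ℚ.*-zeroˡ (∑ c))) rel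

  affine-∷-transversal : LinearlyIndependent T → (h : Vect n) {a : ℚ} → (∀ t → h · T t ≡ a) → h · x ≢ a →
                         AffinelyIndependent (x ∷ T)
  affine-∷-transversal independent h {a} on-hyperplane off c ∑c≡0 rel =
    independent-∷ independent c (head≡0-off-hyperplane h on-hyperplane off c rel (trans (cong (a *_) ∑c≡0) (ℚ.*-zeroʳ a))) rel

-- Spanning forests

-- fuse merges the label b into the label a and renumbers the remaining labels into Fin c.
module Fuse {c} {a b : Fin (suc c)} (a≢b : a ≢ b) where

  avoid-b : Fin (suc c) → Σ (Fin (suc c)) (b ≢_)
  avoid-b x with x Fin.≟ b
  ... | yes _   = a , a≢b ∘ sym
  ... | no x≢b = x , x≢b ∘ sym

  avoid-b-image : ∀ x → (x ≡ b × proj₁ (avoid-b x) ≡ a) ⊎ (x ≢ b × proj₁ (avoid-b x) ≡ x)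
  avoid-b-image x with x Fin.≟ b
  ... | yes x≡b = inj₁ (x≡b , refl)
  ... | no x≢b  = inj₂ (x≢b , refl)

  avoid-b-b : proj₁ (avoid-b b) ≡ a
  avoid-b-b with avoid-b-image b
  ... | inj₁ (_ , b↦a)   = b↦a
  ... | inj₂ (b≢b , _)   = contradiction refl b≢b

  avoid-b-≢ : ∀ {x} → x ≢ b → proj₁ (avoid-b x) ≡ x
  avoid-b-≢ {x} x≢b with avoid-b-image x
  ... | inj₁ (x≡b , _)   = contradiction x≡b x≢b
  ... | inj₂ (_ , x↦x)   = x↦x

  fuse : Fin (suc c) → Fin c
  fuse x = punchOut (proj₂ (avoid-b x))

  fuse-a≡fuse-b : fuse a ≡ fuse b
  fuse-a≡fuse-b = punchOut-cong b (trans (avoid-b-≢ a≢b) (sym avoid-b-b))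

  fuse-punchIn : ∀ j → fuse (punchIn b j) ≡ j
  fuse-punchIn j = trans (punchOut-cong b (avoid-b-≢ (punchInᵢ≢i b j))) (punchOut-punchIn b)

  fuse≡⇒avoid-b≡ : ∀ x y → fuse x ≡ fuse y → proj₁ (avoid-b x) ≡ proj₁ (avoid-b y)
  fuse≡⇒avoid-b≡ x y = punchOut-injective (proj₂ (avoid-b x)) (proj₂ (avoid-b y))

  fuse-fibres : ∀ {x y} → fuse x ≡ fuse y → x ≡ y ⊎ (x ≡ a × y ≡ b) ⊎ (x ≡ b × y ≡ a)
  fuse-fibres {x} {y} fx≡fy with avoid-b-image x | avoid-b-image y
  ... | inj₁ (x≡b , _)   | inj₁ (y≡b , _)   = inj₁ (trans x≡b (sym y≡b))
  ... | inj₁ (x≡b , x↦a) | inj₂ (_ , y↦y)   = inj₂ (inj₂ (x≡b , trans (sym y↦y) (trans (sym (fuse≡⇒avoid-b≡ x y fx≡fy)) x↦a)))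
  ... | inj₂ (_ , x↦x)   | inj₁ (y≡b , y↦a) = inj₂ (inj₁ (trans (sym x↦x) (trans (fuse≡⇒avoid-b≡ x y fx≡fy) y↦a) , y≡b))
  ... | inj₂ (_ , x↦x)   | inj₂ (_ , y↦y)   = inj₁ (trans (sym x↦x) (trans (fuse≡⇒avoid-b≡ x y fx≡fy) y↦y))

Connected-trans : ∀ {n} {Q : Quiver n} {u v w} → Connected Q u v → Connected Q v w → Connected Q u w
Connected-trans here       q = q
Connected-trans (fwd uv p) q = fwd uv (Connected-trans p q)
Connected-trans (bwd vu p) q = bwd vu (Connected-trans p q)

record Forest {n} (Q : Quiver n) (c : ℕ) : Set where
  field
    edges           : ℕ
    edges+c≡n       : edges ℕ.+ c ≡ n
    tree            : Fin n → Fin c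
    tree-surjective : ∀ j → ∃ λ v → tree v ≡ j
    tree-connected  : ∀ {v w} → tree v ≡ tree w → Connected Q v w
    src tgt         : Fin edges → Fin n
    src→tgt         : ∀ t → edge Q (src t) (tgt t) ≡ true
    edge-in-tree    : ∀ t → tree (src t) ≡ tree (tgt t)
    height          : Fin n → ℚ
    height-step     : ∀ t → height (src t) + 1ℚ ≡ height (tgt t)
    ε-spanned       : ∀ {v w} → tree v ≡ tree w → InSpan (λ t → ε (src t) (tgt t)) (ε v w)
    independent     : LinearlyIndependent (λ t → ε (src t) (tgt t))

  edge-vectors : Fin edges → Vect n
  edge-vectors t = ε (src t) (tgt t)

open Forest

trivial-forest : ∀ {n} (Q : Quiver n) → Forest Q n
trivial-forest Q = record
  { edges           = 0
  ; edges+c≡n       = refl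
  ; tree            = λ v → v
  ; tree-surjective = λ v → v , refl
  ; tree-connected  = λ { refl → here }
  ; src             = λ ()
  ; tgt             = λ ()
  ; src→tgt         = λ ()
  ; edge-in-tree    = λ ()
  ; height          = λ _ → 0ℚ
  ; height-step     = λ ()
  ; ε-spanned       = λ { {v} refl → InSpan-resp (λ ()) (ε-self v) (InSpan-zero (λ ())) }
  ; independent     = λ _ _ ()
  }

-- Adding an edge a → b between two trees: the tree of b is fused into that of a and its heights
-- are shifted by `shift`.  The indicator of the tree of b is orthogonal to every old edge vector
-- but not to ε a b, which keeps the edge vectors independent.
module Merge {n} {Q : Quiver n} {c} (F : Forest Q (suc c)) {a b : Fin n}
             (a→b : edge Q a b ≡ true) (apart : tree F a ≢ tree F b) where

  open Fuse apart

  vectors′ : Fin (suc (edges F)) → Vect n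
  vectors′ = ε a b ∷ edge-vectors F

  extend : ∀ {x} → InSpan (edge-vectors F) x → InSpan vectors′ x
  extend = InSpan-∷ (edge-vectors F) (ε a b)

  joined : ∀ {v w} → tree F v ≡ tree F a → tree F w ≡ tree F b → InSpan vectors′ (ε v w)
  joined {v} {w} v~a w~b = InSpan-resp vectors′ telescope
    (InSpan-+ vectors′ (InSpan-+ vectors′ (extend (ε-spanned F v~a)) (InSpan-head (edge-vectors F) (ε a b)))
                       (extend (ε-spanned F (sym w~b))))
    where
    telescope : ε v w ≗ λ u → (ε v a u + ε a b u) + ε b w u
    telescope u = solve 4 (λ v w a b → v :- w := ((v :- a) :+ (a :- b)) :+ (b :- w)) refl (κ v u) (κ w u) (κ a u) (κ b u)

  connected′ : ∀ {v w} → fuse (tree F v) ≡ fuse (tree F w) → Connected Q v w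
  connected′ same with fuse-fibres same
  ... | inj₁ v~w                 = tree-connected F v~w
  ... | inj₂ (inj₁ (v~a , w~b)) = Connected-trans (tree-connected F v~a) (fwd a→b (tree-connected F (sym w~b)))
  ... | inj₂ (inj₂ (v~b , w~a)) = Connected-trans (tree-connected F v~b) (bwd a→b (tree-connected F (sym w~a)))

  spanned′ : ∀ {v w} → fuse (tree F v) ≡ fuse (tree F w) → InSpan vectors′ (ε v w)
  spanned′ {v} {w} same with fuse-fibres same
  ... | inj₁ v~w                 = extend (ε-spanned F v~w)
  ... | inj₂ (inj₁ (v~a , w~b)) = joined v~a w~b
  ... | inj₂ (inj₂ (v~b , w~a)) = InSpan-resp vectors′ (ε-swap v w) (InSpan-* vectors′ (- 1ℚ) (joined w~a v~b))

  in-b-tree : Vect n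
  in-b-tree u = κ (tree F b) (tree F u)

  in-b-tree-a : in-b-tree a ≡ 0ℚ
  in-b-tree-a = κ-off (apart ∘ sym)

  in-b-tree-b : in-b-tree b ≡ 1ℚ
  in-b-tree-b = κ-diag (tree F b)

  in-b-tree-edge : ∀ t → in-b-tree (src F t) ≡ in-b-tree (tgt F t)
  in-b-tree-edge t = cong (κ (tree F b)) (edge-in-tree F t)

  shift : ℚ
  shift = height F a + 1ℚ - height F b

  height′ : Fin n → ℚ
  height′ u = height F u + shift * in-b-tree u

  height′-step : ∀ t → height′ ((a ∷ src F) t) + 1ℚ ≡ height′ ((b ∷ tgt F) t)
  height′-step zero = begin
    height F a + shift * in-b-tree a + 1ℚ
      ≡⟨ cong (λ x → height F a + shift * x + 1ℚ) in-b-tree-a ⟩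
    height F a + shift * 0ℚ + 1ℚ
      ≡⟨ solve 2 (λ x y → x :+ (x :+ con 1ℚ :- y) :* con 0ℚ :+ con 1ℚ := y :+ (x :+ con 1ℚ :- y) :* con 1ℚ)
                 refl (height F a) (height F b) ⟩
    height F b + shift * 1ℚ
      ≡⟨ cong (λ x → height F b + shift * x) (sym in-b-tree-b) ⟩
    height F b + shift * in-b-tree b ∎
    where open ≡-Reasoning
  height′-step (suc t) = begin
    height F s + shift * in-b-tree s + 1ℚ
      ≡⟨ solve 3 (λ h y i → h :+ y :* i :+ con 1ℚ := (h :+ con 1ℚ) :+ y :* i) refl (height F s) shift (in-b-tree s) ⟩
    (height F s + 1ℚ) + shift * in-b-tree s
      ≡⟨ cong₂ (λ x y → x + shift * y) (height-step F t) (in-b-tree-edge t) ⟩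
    height F (tgt F t) + shift * in-b-tree (tgt F t) ∎
    where
    open ≡-Reasoning
    s : Fin n
    s = src F t

  merged : Forest Q c
  merged = record
    { edges           = suc (edges F)
    ; edges+c≡n       = trans (sym (ℕ.+-suc (edges F) c)) (edges+c≡n F)
    ; tree            = fuse ∘ tree F
    ; tree-surjective = λ j → let v , v↦j = tree-surjective F (punchIn (tree F b) j) in v , trans (cong fuse v↦j) (fuse-punchIn j)
    ; tree-connected  = connected′
    ; src             = a ∷ src F
    ; tgt             = b ∷ tgt F
    ; src→tgt         = λ { zero → a→b ; (suc t) → src→tgt F t }
    ; edge-in-tree    = λ { zero → fuse-a≡fuse-b ; (suc t) → cong fuse (edge-in-tree F t) }
    ; height          = height′
    ; height-step     = height′-step
    ; ε-spanned       = spanned′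
    ; independent     = independent-∷-transversal (independent F) in-b-tree ⊥-edges ab-transversal
    }
    where
    ⊥-edges : ∀ t → in-b-tree · edge-vectors F t ≡ 0ℚ
    ⊥-edges t = trans (·-ε in-b-tree (src F t) (tgt F t))
                      (trans (cong (_- in-b-tree (tgt F t)) (in-b-tree-edge t)) (ℚ.+-inverseʳ (in-b-tree (tgt F t))))
    ab-transversal : in-b-tree · ε a b ≢ 0ℚ
    ab-transversal ab⊥ = 0≢-1 (trans (sym ab⊥) (trans (·-ε in-b-tree a b) (cong₂ _-_ in-b-tree-a in-b-tree-b)))
      where
      0≢-1 : 0ℚ ≢ 0ℚ - 1ℚ
      0≢-1 ()

Spanning : ∀ {n} {Q : Quiver n} {c} → Forest Q c → Set
Spanning {Q = Q} F = ∀ {v w} → edge Q v w ≡ true → tree F v ≡ tree F w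

module _ {n} {Q : Quiver n} where

  absorb : ∀ {c} (F : Forest Q c) (a b : Fin n) →
           ∃ λ c′ → Σ (Forest Q c′) λ G →
             (∀ {v w} → tree F v ≡ tree F w → tree G v ≡ tree G w) × (edge Q a b ≡ true → tree G a ≡ tree G b)
  absorb {zero} F a b with tree F a
  ... | ()
  absorb {suc c} F a b with edge Q a b in a→b | tree F a Fin.≟ tree F b
  ... | false | _        = suc c , F , (λ same → same) , λ ()
  ... | true  | yes same = suc c , F , (λ same → same) , λ _ → same
  ... | true  | no apart = c , Merge.merged F a→b apart , cong fuse , λ _ → fuse-a≡fuse-b
    where open Fuse apart

  forest-covering : (L : List (Fin n × Fin n)) → ∃ λ c → Σ (Forest Q c) λ F →
                    ∀ {v w} → (v , w) ∈ L → edge Q v w ≡ true → tree F v ≡ tree F w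
  forest-covering []            = n , trivial-forest Q , λ ()
  forest-covering ((a , b) List.∷ L) =
    let c , F , covers = forest-covering L
        c′ , G , refines , joins = absorb F a b
    in c′ , G , λ { (here refl) → joins ; (there vw∈L) → refines ∘ covers vw∈L }

  spanning-forest : ∃ λ c → Σ (Forest Q c) Spanning
  spanning-forest =
    let c , F , covers = forest-covering (cartesianProduct (allFin n) (allFin n))
    in c , F , λ {v} {w} → covers (∈-cartesianProduct⁺ (∈-allFin v) (∈-allFin w))

  Spanning-connected : ∀ {c} (F : Forest Q c) → Spanning F → ∀ {v w} → Connected Q v w → tree F v ≡ tree F w
  Spanning-connected F spanning here       = refl
  Spanning-connected F spanning (fwd uv p) = trans (spanning uv) (Spanning-connected F spanning p)
  Spanning-connected F spanning (bwd vu p) = trans (sym (spanning vu)) (Spanning-connected F spanning p)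

coarser-surjection⇒≤ : ∀ {n c c′} (f : Fin n → Fin c) (g : Fin n → Fin c′) → (∀ j → ∃ λ v → f v ≡ j) →
                       (∀ {v w} → g v ≡ g w → f v ≡ f w) → c ℕ.≤ c′
coarser-surjection⇒≤ {n} {c} f g f-surjective coarser = Fin.injective⇒≤ {f = g ∘ section} λ {i} {j} gi≡gj →
  trans (sym (proj₂ (f-surjective i))) (trans (coarser gi≡gj) (proj₂ (f-surjective j)))
  where
  section : Fin c → Fin n
  section j = proj₁ (f-surjective j)

trees≡components : ∀ {n} {Q : Quiver n} {c c′} (F : Forest Q c) → Spanning F → NumComponents Q c′ → c ≡ c′
trees≡components F spanning (component , same⇔connected , component-surjective) = ℕ.≤-antisym
  (coarser-surjection⇒≤ (tree F) component (tree-surjective F)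
     (λ same → Spanning-connected F spanning (Equivalence.to (same⇔connected _ _) same)))
  (coarser-surjection⇒≤ component (tree F) component-surjective
     (λ same → Equivalence.from (same⇔connected _ _) (tree-connected F same)))

-- The directed edge polytope

step⇒·ε≡-1 : ∀ {n} (ρ : Vect n) {v w} → ρ v + 1ℚ ≡ ρ w → ρ · ε v w ≡ - 1ℚ
step⇒·ε≡-1 ρ {v} {w} step = begin
  ρ · ε v w          ≡⟨ ·-ε ρ v w ⟩
  ρ v - ρ w          ≡⟨ cong (λ y → ρ v - y) (sym step) ⟩
  ρ v - (ρ v + 1ℚ)   ≡⟨ solve 1 (λ x → x :- (x :+ con 1ℚ) := con (- 1ℚ)) refl (ρ v) ⟩
  - 1ℚ               ∎
  where open ≡-Reasoning

·ε≡-1⇒step : ∀ {n} (ρ : Vect n) {v w} → ρ · ε v w ≡ - 1ℚ → ρ v + 1ℚ ≡ ρ w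
·ε≡-1⇒step ρ {v} {w} ·ε≡-1 = begin
  ρ v + 1ℚ                  ≡⟨ solve 2 (λ x y → x :+ con 1ℚ := (x :- y :+ con 1ℚ) :+ y) refl (ρ v) (ρ w) ⟩
  (ρ v - ρ w + 1ℚ) + ρ w    ≡⟨ cong (λ z → z + 1ℚ + ρ w) (trans (sym (·-ε ρ v w)) ·ε≡-1) ⟩
  (- 1ℚ + 1ℚ) + ρ w         ≡⟨ ℚ.+-identityˡ (ρ w) ⟩
  ρ w                       ∎
  where open ≡-Reasoning

module _ {n} (Q : Quiver n) where

  ε∈DE : ∀ {s t} → edge Q s t ≡ true → DE Q (ε s t)
  ε∈DE {s} {t} s→t = weight , nonneg , off-edge , total , barycentre
    where
    weight : Fin n → Fin n → ℚ
    weight v w = κ s v * κ t w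
    nonneg : ∀ v w → 0ℚ ℚ.≤ weight v w
    nonneg v w with s Fin.≟ v | t Fin.≟ w
    ... | yes _ | yes _ = ℚ.nonNegative⁻¹ 1ℚ
    ... | yes _ | no _  = ℚ.≤-refl
    ... | no _  | yes _ = ℚ.≤-refl
    ... | no _  | no _  = ℚ.≤-refl
    off-edge : ∀ v w → edge Q v w ≡ false → weight v w ≡ 0ℚ
    off-edge v w v↛w with s Fin.≟ v | t Fin.≟ w
    ... | yes refl | yes refl = contradiction (trans (sym s→t) v↛w) λ ()
    ... | yes _    | no _     = refl
    ... | no _     | yes _    = refl
    ... | no _     | no _     = refl
    total : ∑ (λ v → ∑ (λ w → weight v w)) ≡ 1ℚ
    total = trans (∑-cong (λ v → ∑-*κ (λ _ → κ s v) t))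
                  (trans (∑-cong (λ v → sym (ℚ.*-identityˡ (κ s v)))) (∑-*κ (λ _ → 1ℚ) s))
    barycentre : ∀ u → ε s t u ≡ ∑ (λ v → ∑ (λ w → weight v w * ε v w u))
    barycentre u = sym (begin
      ∑ (λ v → ∑ (λ w → κ s v * κ t w * ε v w u))
        ≡⟨ ∑-cong (λ v → ∑-cong (λ w → solve 3 (λ x y z → x :* y :* z := x :* z :* y) refl (κ s v) (κ t w) (ε v w u))) ⟩
      ∑ (λ v → ∑ (λ w → κ s v * ε v w u * κ t w))  ≡⟨ ∑-cong (λ v → ∑-*κ (λ w → κ s v * ε v w u) t) ⟩
      ∑ (λ v → κ s v * ε v t u)                    ≡⟨ ∑-cong (λ v → ℚ.*-comm (κ s v) (ε v t u)) ⟩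
      ∑ (λ v → ε v t u * κ s v)                    ≡⟨ ∑-*κ (λ v → ε v t u) s ⟩
      ε s t u                                      ∎)
      where open ≡-Reasoning

  DE⊆span : ∀ {m} (T : Fin m → Vect n) → (∀ {v w} → edge Q v w ≡ true → InSpan T (ε v w)) →
            ∀ {x} → DE Q x → InSpan T x
  DE⊆span T edges-spanned (weight , _ , off-edge , _ , barycentre) =
    InSpan-resp T barycentre (InSpan-∑ T _ (λ v → InSpan-∑ T _ (λ w → weighted v w)))
    where
    weighted : ∀ v w → InSpan T (λ u → weight v w * ε v w u)
    weighted v w with edge Q v w in v→w
    ... | true  = InSpan-* T (weight v w) (edges-spanned v→w)
    ... | false = InSpan-resp T (λ u → trans (cong (_* ε v w u) (off-edge v w v→w)) (ℚ.*-zeroˡ (ε v w u))) (InSpan-zero T)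

  DE-on-hyperplane : (h : Vect n) {a : ℚ} → (∀ {v w} → edge Q v w ≡ true → h · ε v w ≡ a) →
                     ∀ {x} → DE Q x → h · x ≡ a
  DE-on-hyperplane h {a} on-hyperplane {x} (weight , _ , off-edge , total , barycentre) = begin
    h · x                                                     ≡⟨ ·-cong h barycentre ⟩
    h · (λ u → ∑ (λ v → ∑ (λ w → weight v w * ε v w u)))      ≡⟨ ·-∑ h (λ v u → ∑ (λ w → weight v w * ε v w u)) ⟩
    ∑ (λ v → h · (λ u → ∑ (λ w → weight v w * ε v w u)))      ≡⟨ ∑-cong (λ v → ·-∑ h (λ w u → weight v w * ε v w u)) ⟩
    ∑ (λ v → ∑ (λ w → h · (λ u → weight v w * ε v w u)))      ≡⟨ ∑-cong (λ v → ∑-cong (λ w → ·-* h (weight v w) (ε v w))) ⟩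
    ∑ (λ v → ∑ (λ w → weight v w * h · ε v w))                ≡⟨ ∑-cong (λ v → ∑-cong (weighted v)) ⟩
    ∑ (λ v → ∑ (λ w → weight v w * a))                        ≡⟨ ∑-cong (λ v → ∑-*ʳ a (weight v)) ⟩
    ∑ (λ v → ∑ (λ w → weight v w) * a)                        ≡⟨ ∑-*ʳ a (λ v → ∑ (weight v)) ⟩
    ∑ (λ v → ∑ (λ w → weight v w)) * a                        ≡⟨ cong (_* a) total ⟩
    1ℚ * a                                                    ≡⟨ ℚ.*-identityˡ a ⟩
    a                                                         ∎
    where
    open ≡-Reasoning
    weighted : ∀ v w → weight v w * h · ε v w ≡ weight v w * a
    weighted v w with edge Q v w in v→w
    ... | true  = cong (weight v w *_) (on-hyperplane v→w)
    ... | false = trans (cong (_* h · ε v w) (off-edge v w v→w))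
                        (trans (ℚ.*-zeroˡ (h · ε v w)) (sym (trans (cong (_* a) (off-edge v w v→w)) (ℚ.*-zeroˡ a))))

+n-+c≡+e : ∀ {e c n} → e ℕ.+ c ≡ n → ℤ.+ n ℤ.- ℤ.+ c ≡ ℤ.+ e
+n-+c≡+e {e} {c} refl = trans (cong (ℤ._- ℤ.+ c) (ℤ.pos-+ e c)) (x+y-y≡x (ℤ.+ e) (ℤ.+ c))
  where
  x+y-y≡x : ∀ x y → x ℤ.+ y ℤ.- y ≡ x
  x+y-y≡x = solve-∀

x-1+1≡x : ∀ x → x ℤ.- 1ℤ ℤ.+ 1ℤ ≡ x
x-1+1≡x = solve-∀

HasDim-intro : ∀ {n} (S : Vect n → Set) {d : ℤ} (k : ℕ) → ℤ.+ k ≡ d ℤ.+ 1ℤ →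
               (p : Fin k → Vect n) → (∀ i → S (p i)) → AffinelyIndependent p →
               (∀ k′ (q : Fin k′ → Vect n) → (∀ i → S (q i)) → AffinelyIndependent q → k′ ℕ.≤ k) →
               HasDim S d
HasDim-intro S k k≡d+1 p p∈S p-affine bound =
  (k , k≡d+1 , p , p∈S , p-affine) ,
  λ k′ q q∈S q-affine → subst (ℤ.+ k′ ℤ.≤_) k≡d+1 (ℤ.+≤+ (bound k′ q q∈S q-affine))

violated-edge : ∀ {n} {Q : Quiver n} → ¬ HasRankFunction Q → (ρ : Vect n) →
                ∃ λ v → ∃ λ w → edge Q v w ≡ true × ρ v + 1ℚ ≢ ρ w
violated-edge {Q = Q} no-rank ρ
  with Fin.any? (λ v → Fin.any? (λ w → (edge Q v w Bool.≟ true) ×-dec ¬? (ρ v + 1ℚ ℚ.≟ ρ w)))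
... | yes (v , w , violation) = v , w , violation
... | no none = contradiction (ρ , rank) no-rank
  where
  rank : RankFunction Q ρ
  rank v w v→w = decidable-stable (ρ v + 1ℚ ℚ.≟ ρ w) (λ v↛w → none (v , w , v→w , v↛w))

module Dimension {n} {Q : Quiver n} {c} (F : Forest Q c) (spanning : Spanning F) where

  edge-vectors∈DE : ∀ t → DE Q (edge-vectors F t)
  edge-vectors∈DE t = ε∈DE Q (src→tgt F t)

  DE⊆span-forest : ∀ {x} → DE Q x → InSpan (edge-vectors F) x
  DE⊆span-forest = DE⊆span Q (edge-vectors F) (λ v→w → ε-spanned F (spanning v→w))

  rank-dimension : HasRankFunction Q → HasDim (DE Q) (ℤ.+ edges F ℤ.- 1ℤ)
  rank-dimension (ρ , rank) =
    HasDim-intro (DE Q) {d = ℤ.+ edges F ℤ.- 1ℤ} (edges F) (sym (x-1+1≡x (ℤ.+ edges F)))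
      (edge-vectors F) edge-vectors∈DE (linear⇒affine (independent F))
      λ k q q∈DE q-affine → independent-in-span⇒≤ (edge-vectors F) q (DE⊆span-forest ∘ q∈DE)
                              (affine⇒linear ρ -1≢0 (on-rank-hyperplane ∘ q∈DE) q-affine)
    where
    on-rank-hyperplane : ∀ {x} → DE Q x → ρ · x ≡ - 1ℚ
    on-rank-hyperplane = DE-on-hyperplane Q ρ (λ {v} {w} v→w → step⇒·ε≡-1 ρ (rank v w v→w))
    -1≢0 : - 1ℚ ≢ 0ℚ
    -1≢0 ()

  no-rank-dimension : ¬ HasRankFunction Q → HasDim (DE Q) (ℤ.+ edges F)
  no-rank-dimension no-rank =
    let v , w , v→w , violation = violated-edge {Q = Q} no-rank (height F) in
    HasDim-intro (DE Q) {d = ℤ.+ edges F} (suc (edges F)) (cong ℤ.+_ (ℕ.+-comm 1 (edges F)))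
      (ε v w ∷ edge-vectors F) (λ { zero → ε∈DE Q v→w ; (suc t) → edge-vectors∈DE t })
      (affine-∷-transversal (independent F) (height F) forest-on-height-hyperplane (violation ∘ ·ε≡-1⇒step (height F)))
      λ k q q∈DE q-affine → independent-in-span⇒≤ (homogenised-span (edge-vectors F)) (homogenise q)
                              (λ i → InSpan-homogenise (edge-vectors F) (DE⊆span-forest (q∈DE i)))
                              (affine⇒homogenised-linear q-affine)
    where
    forest-on-height-hyperplane : ∀ t → height F · edge-vectors F t ≡ - 1ℚ
    forest-on-height-hyperplane t = step⇒·ε≡-1 (height F) (height-step F t)

theorem1p1 : ∀ {n} (Q : Quiver n) (c : ℕ) → NumComponents Q c →
    (HasRankFunction Q → HasDim (DE Q) (ℤ.+ n ℤ.- ℤ.+ c ℤ.- 1ℤ))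
    × (¬ HasRankFunction Q → HasDim (DE Q) (ℤ.+ n ℤ.- ℤ.+ c))
theorem1p1 {n} Q c components with spanning-forest {Q = Q}
... | _ , F , spanning =
  (λ rank → subst (λ d → HasDim (DE Q) (d ℤ.- 1ℤ)) (sym n-c≡edges) (rank-dimension rank)) ,
  (λ no-rank → subst (HasDim (DE Q)) (sym n-c≡edges) (no-rank-dimension no-rank))
  where
  open Dimension F spanning
  n-c≡edges : ℤ.+ n ℤ.- ℤ.+ c ≡ ℤ.+ edges F
  n-c≡edges = +n-+c≡+e (trans (cong (edges F ℕ.+_) (sym (trees≡components F spanning components))) (edges+c≡n F))
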